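{- Let $n,m\ge 2$. Suppose there is a total $2$-dominating set $S$ of $K_n\Box K_m$ with $|S|=\gamma_{2t}(K_n\Box K_m)$ such that $S\cap(\{v\}\times V(K_m))\neq\emptyset$ for every $v\in V(K_n)$ and $S\cap(V(K_n)\times\{w\})\neq\emptyset$ for every $w\in V(K_m)$. Then \[ \gamma_{2t}(K_{n+4}\Box K_{m+4})=\gamma_{2t}(K_n\Box K_m)+6. \]
   Context: $K_n$ denotes the complete graph on $n$ vertices. The Cartesian product $G\Box H$ has vertex set $V(G)\times V(H)$, with $(u_1,v_1)\sim(u_2,v_2)$ iff either $u_1=u_2$ and $v_1\sim v_2$, or $v_1=v_2$ and $u_1\sim u_2$. A set $S$ of vertices of a graph $G$ is total $2$-dominating if every vertex of $G$ is adjacent to at least two vertices of $S$; $\gamma_{2t}(G)$ is the minimum cardinality of such a set. -}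

module Defs where

open import Data.Nat using (ℕ; _+_; _≤_)
open import Data.Fin using (Fin)
open import Data.Bool using (Bool; true; false; if_then_else_)
open import Data.Product using (_×_; _,_; ∃-syntax)
open import Data.List using (List; map; allFin)
open import Data.Nat.ListAction using (sum)
open import Data.Sum using (_⊎_)
open import Relation.Nullary using (¬_)
open import Relation.Binary.PropositionalEquality using (_≡_)

-- Vertices of K_n □ K_m : pairs (Fin n × Fin m).
-- A vertex set S is given by its characteristic function.
VSet : ℕ → ℕ → Set
VSet n m = Fin n → Fin m → Bool

Adj : ∀ {n m} → Fin n × Fin m → Fin n × Fin m → Set
Adj (u₁ , v₁) (u₂ , v₂) = (u₁ ≡ u₂ × ¬ v₁ ≡ v₂) ⊎ (v₁ ≡ v₂ × ¬ u₁ ≡ u₂)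

_∈S_ : ∀ {n m} → Fin n × Fin m → VSet n m → Set
(u , v) ∈S S = S u v ≡ true

count : ∀ {n m} → VSet n m → ℕ
count {n} {m} S = sum (map (λ u → sum (map (λ v → if S u v then 1 else 0) (allFin m))) (allFin n))

IsTotal2Dom : ∀ {n m} → VSet n m → Set
IsTotal2Dom {n} {m} S = ∀ (x : Fin n × Fin m) →
  ∃[ y ] ∃[ z ] (¬ y ≡ z × Adj x y × Adj x z × y ∈S S × z ∈S S)

IsGamma2t : ℕ → ℕ → ℕ → Set
IsGamma2t n m k = (∃[ S ] (IsTotal2Dom {n} {m} S × count S ≡ k))
                × (∀ (S : VSet n m) → IsTotal2Dom S → k ≤ count S)

module Submission where

-- A set S of cells of K_n □ K_m is total 2-dominating iff every cell (i, j) has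
-- r_i + c_j ≥ 2 + 2·[(i, j) ∈ S], where r and c are the row and column degrees of S, since
-- the neighbours of (i, j) in S are the other cells of S in its row and column.
-- Upper bound: a K_{1,3}-shaped block of six cells on four new rows and columns, placed
-- diagonally next to S, keeps this inequality as long as S meets every row and column.
-- Lower bound: let T be total 2-dominating on (n+4) × (m+4). An empty row forces two cells
-- in every column, so |T| ≥ 2(m + 4). Otherwise call a line with a single cell a leaf; a
-- non-leaf row has deficit max(0, 2 − #cells outside leaf columns). Counting cells through
-- leaves gives 2(N + M) ≤ 2|T| + D_r + D_c for the total deficits, and a deficient row
-- needs extra cells in leaf columns, so D_r + E_r + E_c ≤ M, where E counts deficient
-- lines. Explicit patterns of size 2·min(n, m) and n + m − a − b (for a + 3b ≤ n and
-- 3a + b ≤ m) bound γ_{2t}(K_n □ K_m) from above, and a parity case analysis turns these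
-- inequalities into |T| ≥ γ_{2t}(K_n □ K_m) + 6.

open import Defs
open import Data.Nat using (ℕ; _+_; _≤_)
open import Data.Fin using (Fin)
open import Data.Product using (_×_; _,_; ∃-syntax)

open import Data.Nat.Properties
open import Algebra.Properties.CommutativeMonoid.Sum +-0-commutativeMonoid
  using (sum; sum-syntax; ∑-distrib-+; ∑-comm; sum-cong-≗)
open import Algebra.Properties.CommutativeSemigroup +-commutativeSemigroup using (x∙yz≈y∙xz)
open import Data.Bool using (Bool; true; false; if_then_else_; _∧_; _∨_; not; T)
open import Data.Bool.Properties using (T-≡; T-∧; ∨-zeroʳ)
open import Data.Empty using (⊥-elim)
open import Data.Fin using (zero; suc; toℕ; fromℕ<; splitAt; _↑ˡ_; _↑ʳ_)
open import Data.Fin.Patterns using (0F; 1F; 2F)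
open import Data.Fin.Properties
  using (splitAt-↑ˡ; splitAt-↑ʳ; any?; toℕ-injective; toℕ-fromℕ<; toℕ<n; fromℕ<-injective)
  renaming (_≟_ to _≟ᶠ_)
open import Data.List using (allFin; map; tabulate)
open import Data.List.Properties using (map-tabulate)
open import Data.Nat
  using (zero; suc; pred; _*_; _∸_; _<_; _%_; z≤n; s≤s; _≤ᵇ_; _≡ᵇ_; NonZero; >-nonZero⁻¹)
open import Data.Nat.DivMod using (m%n<n; [m+kn]%n≡m%n; m<n⇒m%n≡m; n%1≡0)
open import Data.Nat.ListAction as List using ()
open import Data.Nat.Tactic.RingSolver using (solve-∀)
open import Data.Product using (proj₁; proj₂)
open import Data.Sum using (_⊎_; inj₁; inj₂; [_,_]′)
open import Data.Vec.Functional using (Vector; updateAt)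
open import Data.Vec.Functional.Properties using (updateAt-updates; updateAt-minimal)
open import Function using (_∘_; id; const; _⇔_; mk⇔; Equivalence)
open import Relation.Binary.PropositionalEquality
open import Relation.Nullary using (¬_; yes; no)

+≡⇒≤ : ∀ {x y} k → x + k ≡ y → x ≤ y
+≡⇒≤ {x} k refl = m≤m+n x k

≤-reduce : ∀ {x x′ y y′} j k → x′ ≡ x + j + k → y′ ≡ y + k → x′ ≤ y′ → x ≤ y
≤-reduce {x} {y = y} j k refl refl h = ≤-trans (m≤m+n x j) (+-cancelʳ-≤ k (x + j) y h)

≤-extend : ∀ {x y x′ y′} k → x + k ≡ x′ → y + k ≡ y′ → x ≤ y → x′ ≤ y′
≤-extend k refl refl x≤y = +-monoˡ-≤ k x≤y

-- Finite sums and subsets of Fin n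

χ : Bool → ℕ
χ b = if b then 1 else 0

χ≤1 : ∀ b → χ b ≤ 1
χ≤1 true  = ≤-refl
χ≤1 false = z≤n

∑-mono-≤ : ∀ {n} {f g : Vector ℕ n} → (∀ i → f i ≤ g i) → sum f ≤ sum g
∑-mono-≤ {zero}  _   = z≤n
∑-mono-≤ {suc n} f≤g = +-mono-≤ (f≤g zero) (∑-mono-≤ (f≤g ∘ suc))

∑-const : ∀ n c → ∑[ i < n ] c ≡ n * c
∑-const zero    c = refl
∑-const (suc n) c = cong (c +_) (∑-const n c)

∑-zero : ∀ n → ∑[ i < n ] 0 ≡ 0
∑-zero n = trans (∑-const n 0) (*-zeroʳ n)

∑-↑ : ∀ n k (f : Fin (n + k) → ℕ) → sum f ≡ ∑[ u < n ] f (u ↑ˡ k) + ∑[ p < k ] f (n ↑ʳ p)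
∑-↑ zero    k f = refl
∑-↑ (suc n) k f = trans (cong (f zero +_) (∑-↑ n k (f ∘ suc))) (sym (+-assoc (f zero) _ _))

∣_∣ : ∀ {n} → Vector Bool n → ℕ
∣ A ∣ = sum (χ ∘ A)

_─_ : ∀ {n} → Vector Bool n → Fin n → Vector Bool n
A ─ k = updateAt A k (const false)

∣∣-full : ∀ n → ∣ (λ (_ : Fin n) → true) ∣ ≡ n
∣∣-full n = trans (∑-const n 1) (*-identityʳ n)

∣∣+∣∁∣ : ∀ {n} (A : Vector Bool n) → ∣ A ∣ + ∣ not ∘ A ∣ ≡ n
∣∣+∣∁∣ {n} A = trans (sym (∑-distrib-+ (χ ∘ A) (χ ∘ not ∘ A)))
                     (trans (sum-cong-≗ (χ+χ∘not ∘ A)) (∣∣-full n))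
  where
  χ+χ∘not : ∀ b → χ b + χ (not b) ≡ 1
  χ+χ∘not true  = refl
  χ+χ∘not false = refl

∣∣-mono : ∀ {n} {A B : Vector Bool n} → (∀ i → A i ≡ true → B i ≡ true) → ∣ A ∣ ≤ ∣ B ∣
∣∣-mono {A = A} {B} A⊆B = ∑-mono-≤ pointwise
  where
  pointwise : ∀ i → χ (A i) ≤ χ (B i)
  pointwise i with A i in eq
  ... | true  = ≤-reflexive (cong χ (sym (A⊆B i eq)))
  ... | false = z≤n

∣∣-remove : ∀ {n} (A : Vector Bool n) k → ∣ A ∣ ≡ χ (A k) + ∣ A ─ k ∣
∣∣-remove {suc n} A zero    = refl
∣∣-remove {suc n} A (suc k) = begin
  χ (A zero) + ∣ A ∘ suc ∣                        ≡⟨ cong (χ (A zero) +_) (∣∣-remove (A ∘ suc) k) ⟩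
  χ (A zero) + (χ (A (suc k)) + ∣ (A ∘ suc) ─ k ∣) ≡⟨ x∙yz≈y∙xz (χ (A zero)) (χ (A (suc k))) ∣ (A ∘ suc) ─ k ∣ ⟩
  χ (A (suc k)) + (χ (A zero) + ∣ (A ∘ suc) ─ k ∣) ∎
  where open ≡-Reasoning

∣A∣≡1+∣A─k∣ : ∀ {n} (A : Vector Bool n) {k} → A k ≡ true → ∣ A ∣ ≡ 1 + ∣ A ─ k ∣
∣A∣≡1+∣A─k∣ A {k} k∈A = trans (∣∣-remove A k) (cong (λ b → χ b + ∣ A ─ k ∣) k∈A)

∈─ : ∀ {n} (A : Vector Bool n) {k l} → A l ≡ true → ¬ l ≡ k → (A ─ k) l ≡ true
∈─ A {k} {l} l∈A l≢k = trans (updateAt-minimal l k A l≢k) l∈A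

∈─⇒∈ : ∀ {n} (A : Vector Bool n) {k l} → (A ─ k) l ≡ true → A l ≡ true × ¬ l ≡ k
∈─⇒∈ A {k} {l} l∈A─k with l ≟ᶠ k
... | yes refl = ⊥-elim (false≢true (trans (sym (updateAt-updates k A)) l∈A─k))
  where
  false≢true : ¬ false ≡ true
  false≢true ()
... | no l≢k = trans (sym (updateAt-minimal l k A l≢k)) l∈A─k , l≢k

≤∣─∣⇒<∣∣ : ∀ {n} (A : Vector Bool n) {k} → A k ≡ true → ∀ m → m ≤ ∣ A ─ k ∣ → m < ∣ A ∣
≤∣─∣⇒<∣∣ A {k} k∈A m m≤ = subst (suc m ≤_) (sym (∣A∣≡1+∣A─k∣ A k∈A)) (s≤s m≤)

1≤∣∣ : ∀ {n} (A : Vector Bool n) {k} → A k ≡ true → 1 ≤ ∣ A ∣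
1≤∣∣ A k∈A = ≤∣─∣⇒<∣∣ A k∈A 0 z≤n

2≤∣∣ : ∀ {n} (A : Vector Bool n) {k l} → A k ≡ true → A l ≡ true → ¬ l ≡ k → 2 ≤ ∣ A ∣
2≤∣∣ A {k} k∈A l∈A l≢k = ≤∣─∣⇒<∣∣ A k∈A 1 (1≤∣∣ (A ─ k) (∈─ A l∈A l≢k))

3≤∣∣ : ∀ {n} (A : Vector Bool n) {k l p} → A k ≡ true → A l ≡ true → A p ≡ true →
       ¬ l ≡ k → ¬ p ≡ k → ¬ p ≡ l → 3 ≤ ∣ A ∣
3≤∣∣ A {k} k∈A l∈A p∈A l≢k p≢k p≢l =
  ≤∣─∣⇒<∣∣ A k∈A 2 (2≤∣∣ (A ─ k) (∈─ A l∈A l≢k) (∈─ A p∈A p≢k) p≢l)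

∣∣≥1⇒∈ : ∀ {n} (A : Vector Bool n) → 1 ≤ ∣ A ∣ → ∃[ k ] A k ≡ true
∣∣≥1⇒∈ {suc n} A 1≤∣A∣ with A zero in eq
... | true  = zero , eq
... | false with ∣∣≥1⇒∈ (A ∘ suc) 1≤∣A∣
...   | k , k∈A = suc k , k∈A

∣∣≥2⇒∈∈ : ∀ {n} (A : Vector Bool n) → 2 ≤ ∣ A ∣ → ∃[ k ] ∃[ l ] (A k ≡ true × A l ≡ true × ¬ l ≡ k)
∣∣≥2⇒∈∈ A 2≤∣A∣ with ∣∣≥1⇒∈ A (≤-trans (s≤s z≤n) 2≤∣A∣)
... | k , k∈A with ∣∣≥1⇒∈ (A ─ k) (rest k∈A)
  where
  rest : ∀ {k} → A k ≡ true → 1 ≤ ∣ A ─ k ∣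
  rest {k} k∈A = +-cancelˡ-≤ 1 1 _ (subst (2 ≤_) (∣A∣≡1+∣A─k∣ A k∈A) 2≤∣A∣)
...   | l , l∈A─k with ∈─⇒∈ A l∈A─k
...     | l∈A , l≢k = k , l , k∈A , l∈A , l≢k

∣≡ᵇtoℕ∣≤1 : ∀ {m} r → ∣ (λ (j : Fin m) → r ≡ᵇ toℕ j) ∣ ≤ 1
∣≡ᵇtoℕ∣≤1 {zero}  r       = z≤n
∣≡ᵇtoℕ∣≤1 {suc m} zero    = ≤-reflexive (cong suc (∑-zero m))
∣≡ᵇtoℕ∣≤1 {suc m} (suc r) = ∣≡ᵇtoℕ∣≤1 {m} r

∣≤ᵇtoℕ∣ : ∀ {n} o → ∣ (λ (i : Fin n) → o ≤ᵇ toℕ i) ∣ ≡ n ∸ o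
∣≤ᵇtoℕ∣ {zero}  o       = sym (0∸n≡0 o)
∣≤ᵇtoℕ∣ {suc n} zero    = cong suc (∣≤ᵇtoℕ∣ {n} 0)
∣≤ᵇtoℕ∣ {suc n} (suc o) = trans (sum-cong-≗ {n} (λ i → cong χ (suc≤ᵇsuc o (toℕ i)))) (∣≤ᵇtoℕ∣ {n} o)
  where
  suc≤ᵇsuc : ∀ o x → (suc o ≤ᵇ suc x) ≡ (o ≤ᵇ x)
  suc≤ᵇsuc zero    x = refl
  suc≤ᵇsuc (suc o) x = refl

inClass : ℕ → (d : ℕ) .{{_ : NonZero d}} → ℕ → ℕ → Bool
inClass o d k x = (o ≤ᵇ x) ∧ ((x ∸ o) % d ≡ᵇ k)

module _ {o d k x : ℕ} .{{_ : NonZero d}} where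

  inClass-intro : o ≤ x → (x ∸ o) % d ≡ k → inClass o d k x ≡ true
  inClass-intro o≤x x≡k = Equivalence.to T-≡ (Equivalence.from T-∧ (≤⇒≤ᵇ o≤x , ≡⇒≡ᵇ _ k x≡k))

  inClass-elim : inClass o d k x ≡ true → o ≤ x × (x ∸ o) % d ≡ k
  inClass-elim x∈ = ≤ᵇ⇒≤ o x (proj₁ both) , ≡ᵇ⇒≡ _ k (proj₂ both)
    where
    both : T (o ≤ᵇ x) × T ((x ∸ o) % d ≡ᵇ k)
    both = Equivalence.to T-∧ (Equivalence.from T-≡ x∈)

3≤∣class∣ : ∀ {N} o d .{{_ : NonZero d}} {k} → k < d → o + 3 * d ≤ N →
  3 ≤ ∣ (λ (x : Fin N) → inClass o d k (toℕ x)) ∣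
3≤∣class∣ {N} o d {k} k<d o+3d≤N =
  3≤∣∣ (λ x → inClass o d k (toℕ x)) (∈class 0F) (∈class 1F) (∈class 2F)
    (distinct 0F 1F (λ ())) (distinct 0F 2F (λ ())) (distinct 1F 2F (λ ()))
  where
  offset : Fin 3 → ℕ
  offset c = k + toℕ c * d

  point< : ∀ c → o + offset c < N
  point< c = <-≤-trans (+-monoʳ-< o (+-mono-<-≤ k<d (*-monoˡ-≤ d (≤-pred (toℕ<n c)))))
                       (≤-trans (≤-reflexive (cong (o +_) (d+2d≡3d d))) o+3d≤N)
    where
    d+2d≡3d : ∀ d → d + 2 * d ≡ 3 * d
    d+2d≡3d = solve-∀

  point : Fin 3 → Fin N
  point c = fromℕ< (point< c)

  ∈class : ∀ c → inClass o d k (toℕ (point c)) ≡ true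
  ∈class c = inClass-intro (subst (o ≤_) (sym (toℕ-fromℕ< (point< c))) (m≤m+n o (offset c)))
    (begin
      (toℕ (point c) ∸ o) % d  ≡⟨ cong (λ x → (x ∸ o) % d) (toℕ-fromℕ< (point< c)) ⟩
      (o + offset c ∸ o) % d   ≡⟨ cong (_% d) (m+n∸m≡n o (offset c)) ⟩
      (k + toℕ c * d) % d      ≡⟨ [m+kn]%n≡m%n k (toℕ c) d ⟩
      k % d                    ≡⟨ m<n⇒m%n≡m k<d ⟩
      k                        ∎)
    where open ≡-Reasoning

  distinct : ∀ c c′ → ¬ c′ ≡ c → ¬ point c′ ≡ point c
  distinct c c′ c′≢c eq = c′≢c (toℕ-injective (*-cancelʳ-≡ (toℕ c′) (toℕ c) d
    (+-cancelˡ-≡ k _ _ (+-cancelˡ-≡ o _ _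
      (trans (sym (toℕ-fromℕ< (point< c′))) (trans (cong toℕ eq) (toℕ-fromℕ< (point< c))))))))

-- Degrees in K_n □ K_m

rowDeg : ∀ {n m} → VSet n m → Fin n → ℕ
rowDeg S i = ∣ S i ∣

colDeg : ∀ {n m} → VSet n m → Fin m → ℕ
colDeg S j = ∣ (λ i → S i j) ∣

infix 10 _ᵀ

_ᵀ : ∀ {n m} → VSet n m → VSet m n
(S ᵀ) j i = S i j

count≡∑rowDeg : ∀ {n m} (S : VSet n m) → count S ≡ ∑[ i < n ] rowDeg S i
count≡∑rowDeg {n} {m} S =
  trans (sumˡ-allFin (λ i → List.sum (map (χ ∘ S i) (allFin m))))
        (sum-cong-≗ (λ i → sumˡ-allFin (χ ∘ S i)))
  where
  sumˡ-tabulate : ∀ {k} (f : Fin k → ℕ) → List.sum (tabulate f) ≡ sum f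
  sumˡ-tabulate {zero}  f = refl
  sumˡ-tabulate {suc k} f = cong (f zero +_) (sumˡ-tabulate (f ∘ suc))
  sumˡ-allFin : ∀ {k} (f : Fin k → ℕ) → List.sum (map f (allFin k)) ≡ sum f
  sumˡ-allFin f = trans (cong List.sum (map-tabulate id f)) (sumˡ-tabulate f)

∑rowDeg≡∑colDeg : ∀ {n m} (S : VSet n m) → ∑[ i < n ] rowDeg S i ≡ ∑[ j < m ] colDeg S j
∑rowDeg≡∑colDeg S = ∑-comm (λ i j → χ (S i j))

count-ᵀ : ∀ {n m} (S : VSet n m) → count (S ᵀ) ≡ count S
count-ᵀ S = trans (count≡∑rowDeg (S ᵀ)) (trans (sym (∑rowDeg≡∑colDeg S)) (sym (count≡∑rowDeg S)))

DegreeDominating : ∀ {n m} → VSet n m → Set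
DegreeDominating S = ∀ i j → 2 + 2 * χ (S i j) ≤ rowDeg S i + colDeg S j

DegreeDominating-ᵀ : ∀ {n m} (S : VSet n m) → DegreeDominating S → DegreeDominating (S ᵀ)
DegreeDominating-ᵀ S dom j i = subst (2 + 2 * χ (S i j) ≤_) (+-comm (rowDeg S i) (colDeg S j)) (dom i j)

rowNbrs : ∀ {n m} → VSet n m → Fin n → Fin m → Vector Bool m
rowNbrs S i j = S i ─ j

colNbrs : ∀ {n m} → VSet n m → Fin n → Fin m → Vector Bool n
colNbrs S i j = (λ i′ → S i′ j) ─ i

2≤nbrs⇔degree : ∀ {n m} (S : VSet n m) i j →
  (2 ≤ ∣ rowNbrs S i j ∣ + ∣ colNbrs S i j ∣) ⇔ (2 + 2 * χ (S i j) ≤ rowDeg S i + colDeg S j)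
2≤nbrs⇔degree S i j = mk⇔
  (λ h → subst₂ _≤_ (+-comm (2 * v) 2) (sym degrees≡) (+-monoʳ-≤ (2 * v) h))
  (λ h → +-cancelˡ-≤ (2 * v) 2 _ (subst₂ _≤_ (+-comm 2 (2 * v)) degrees≡ h))
  where
  v R C : ℕ
  v = χ (S i j)
  R = ∣ rowNbrs S i j ∣
  C = ∣ colNbrs S i j ∣
  degrees≡ : rowDeg S i + colDeg S j ≡ 2 * v + (R + C)
  degrees≡ = trans (cong₂ _+_ (∣∣-remove (S i) j) (∣∣-remove (λ i′ → S i′ j) i)) (regroup v R C)
    where
    regroup : ∀ v R C → (v + R) + (v + C) ≡ 2 * v + (R + C)
    regroup = solve-∀

module _ {n m} (S : VSet n m) {i : Fin n} {j : Fin m} where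

  rowNbr : ∀ {j′} → rowNbrs S i j j′ ≡ true → Adj (i , j) (i , j′) × (i , j′) ∈S S
  rowNbr j′∈ with ∈─⇒∈ (S i) j′∈
  ... | j′∈S , j′≢j = inj₁ (refl , j′≢j ∘ sym) , j′∈S

  colNbr : ∀ {i′} → colNbrs S i j i′ ≡ true → Adj (i , j) (i′ , j) × (i′ , j) ∈S S
  colNbr i′∈ with ∈─⇒∈ (λ i″ → S i″ j) i′∈
  ... | i′∈S , i′≢i = inj₂ (refl , i′≢i ∘ sym) , i′∈S

  nbr-in-row-or-col : ∀ {y} → Adj (i , j) y → y ∈S S →
    (∃[ j′ ] (y ≡ (i , j′) × rowNbrs S i j j′ ≡ true)) ⊎ (∃[ i′ ] (y ≡ (i′ , j) × colNbrs S i j i′ ≡ true))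
  nbr-in-row-or-col (inj₁ (refl , j≢j′)) y∈S = inj₁ (_ , refl , ∈─ (S i) y∈S (j≢j′ ∘ sym))
  nbr-in-row-or-col (inj₂ (refl , i≢i′)) y∈S = inj₂ (_ , refl , ∈─ (λ i″ → S i″ j) y∈S (i≢i′ ∘ sym))

  two-nbrs⇒2≤nbrs : ∀ {y z} → ¬ y ≡ z → Adj (i , j) y → Adj (i , j) z → y ∈S S → z ∈S S →
    2 ≤ ∣ rowNbrs S i j ∣ + ∣ colNbrs S i j ∣
  two-nbrs⇒2≤nbrs y≢z adj-y adj-z y∈S z∈S
    with nbr-in-row-or-col adj-y y∈S | nbr-in-row-or-col adj-z z∈S
  ... | inj₁ (_ , refl , y∈R) | inj₁ (_ , refl , z∈R) =
    ≤-trans (2≤∣∣ (rowNbrs S i j) y∈R z∈R (y≢z ∘ cong (i ,_) ∘ sym)) (m≤m+n _ _)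
  ... | inj₁ (_ , refl , y∈R) | inj₂ (_ , refl , z∈C) = +-mono-≤ (1≤∣∣ (rowNbrs S i j) y∈R) (1≤∣∣ (colNbrs S i j) z∈C)
  ... | inj₂ (_ , refl , y∈C) | inj₁ (_ , refl , z∈R) = +-mono-≤ (1≤∣∣ (rowNbrs S i j) z∈R) (1≤∣∣ (colNbrs S i j) y∈C)
  ... | inj₂ (_ , refl , y∈C) | inj₂ (_ , refl , z∈C) =
    ≤-trans (2≤∣∣ (colNbrs S i j) y∈C z∈C (y≢z ∘ cong (_, j) ∘ sym)) (m≤n+m _ _)

  2≤nbrs⇒two-nbrs : 2 ≤ ∣ rowNbrs S i j ∣ + ∣ colNbrs S i j ∣ →
    ∃[ y ] ∃[ z ] (¬ y ≡ z × Adj (i , j) y × Adj (i , j) z × y ∈S S × z ∈S S)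
  2≤nbrs⇒two-nbrs 2≤R+C with 2 ≤? ∣ rowNbrs S i j ∣ | 1 ≤? ∣ rowNbrs S i j ∣
  ... | yes 2≤R | _ with ∣∣≥2⇒∈∈ (rowNbrs S i j) 2≤R
  ...   | k , l , k∈R , l∈R , l≢k with rowNbr k∈R | rowNbr l∈R
  ...     | adj-k , k∈S | adj-l , l∈S = _ , _ , l≢k ∘ sym ∘ cong proj₂ , adj-k , adj-l , k∈S , l∈S
  2≤nbrs⇒two-nbrs 2≤R+C | no R<2 | yes 1≤R with ∣∣≥1⇒∈ (rowNbrs S i j) 1≤R | ∣∣≥1⇒∈ (colNbrs S i j) 1≤C
    where
    1≤C : 1 ≤ ∣ colNbrs S i j ∣
    1≤C = +-cancelˡ-≤ 1 1 _ (≤-trans 2≤R+C (+-monoˡ-≤ _ (≤-pred (≰⇒> R<2))))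
  ...   | k , k∈R | l , l∈C with rowNbr k∈R | colNbr l∈C
  ...     | adj-k , k∈S | adj-l , l∈S = _ , _ , proj₂ (∈─⇒∈ (S i) k∈R) ∘ cong proj₂ , adj-k , adj-l , k∈S , l∈S
  2≤nbrs⇒two-nbrs 2≤R+C | no _ | no R<1 with ∣∣≥2⇒∈∈ (colNbrs S i j) 2≤C
    where
    2≤C : 2 ≤ ∣ colNbrs S i j ∣
    2≤C = subst (λ r → 2 ≤ r + _) (n<1⇒n≡0 (≰⇒> R<1)) 2≤R+C
  ...   | k , l , k∈C , l∈C , l≢k with colNbr k∈C | colNbr l∈C
  ...     | adj-k , k∈S | adj-l , l∈S = _ , _ , l≢k ∘ sym ∘ cong proj₁ , adj-k , adj-l , k∈S , l∈S

total2Dom⇒degreeDominating : ∀ {n m} (S : VSet n m) → IsTotal2Dom S → DegreeDominating S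
total2Dom⇒degreeDominating S dom i j with dom (i , j)
... | _ , _ , y≢z , adj-y , adj-z , y∈S , z∈S =
  Equivalence.to (2≤nbrs⇔degree S i j) (two-nbrs⇒2≤nbrs S y≢z adj-y adj-z y∈S z∈S)

degreeDominating⇒total2Dom : ∀ {n m} (S : VSet n m) → DegreeDominating S → IsTotal2Dom S
degreeDominating⇒total2Dom S deg (i , j) =
  2≤nbrs⇒two-nbrs S (Equivalence.from (2≤nbrs⇔degree S i j) (deg i j))

degreeDominating-from-degrees : ∀ {n m} (S : VSet n m) →
  (∀ i j → 2 ≤ rowDeg S i + colDeg S j) →
  (∀ i j → S i j ≡ true → 4 ≤ rowDeg S i + colDeg S j) → DegreeDominating S
degreeDominating-from-degrees S 2≤deg 4≤deg i j with S i j in eq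
... | true  = 4≤deg i j eq
... | false = 2≤deg i j

-- Total 2-dominating patterns

infixl 6 _∪_

_∪_ : ∀ {n m} → VSet n m → VSet n m → VSet n m
(S ∪ U) i j = S i j ∨ U i j

∨-true : ∀ {x y} → x ∨ y ≡ true → x ≡ true ⊎ y ≡ true
∨-true {true}  _ = inj₁ refl
∨-true {false} e = inj₂ e

∈∪ˡ : ∀ {n m} (S U : VSet n m) {i j} → S i j ≡ true → (S ∪ U) i j ≡ true
∈∪ˡ S U e = cong (_∨ U _ _) e

∈∪ʳ : ∀ {n m} (S U : VSet n m) {i j} → U i j ≡ true → (S ∪ U) i j ≡ true
∈∪ʳ S U {i} {j} e = trans (cong (S i j ∨_) e) (∨-zeroʳ (S i j))

χ-∨ : ∀ x y → χ (x ∨ y) ≤ χ x + χ y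
χ-∨ true  y = s≤s z≤n
χ-∨ false y = ≤-refl

count-∪ : ∀ {n m} (S U : VSet n m) → count (S ∪ U) ≤ count S + count U
count-∪ {n} {m} S U = begin
  count (S ∪ U)                                 ≡⟨ count≡∑rowDeg (S ∪ U) ⟩
  ∑[ i < n ] rowDeg (S ∪ U) i                   ≤⟨ ∑-mono-≤ (λ i → ∑-mono-≤ (λ j → χ-∨ (S i j) (U i j))) ⟩
  ∑[ i < n ] ∑[ j < m ] (χ (S i j) + χ (U i j)) ≡⟨ sum-cong-≗ (λ i → ∑-distrib-+ (χ ∘ S i) (χ ∘ U i)) ⟩
  ∑[ i < n ] (rowDeg S i + rowDeg U i)          ≡⟨ ∑-distrib-+ (rowDeg S) (rowDeg U) ⟩
  ∑[ i < n ] rowDeg S i + ∑[ i < n ] rowDeg U i ≡⟨ cong₂ _+_ (count≡∑rowDeg S) (count≡∑rowDeg U) ⟨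
  count S + count U                             ∎
  where open ≤-Reasoning

firstTwoRows : ∀ n m → VSet (2 + n) m
firstTwoRows n m zero          _ = true
firstTwoRows n m (suc zero)    _ = true
firstTwoRows n m (suc (suc _)) _ = false

colDeg-firstTwoRows : ∀ n m j → colDeg (firstTwoRows n m) j ≡ 2
colDeg-firstTwoRows n m j = cong (2 +_) (∑-zero n)

count-firstTwoRows : ∀ n m → count (firstTwoRows n m) ≡ m * 2
count-firstTwoRows n m = begin
  count (firstTwoRows n m)                    ≡⟨ count≡∑rowDeg (firstTwoRows n m) ⟩
  ∑[ i < 2 + n ] rowDeg (firstTwoRows n m) i  ≡⟨ ∑rowDeg≡∑colDeg (firstTwoRows n m) ⟩
  ∑[ j < m ] colDeg (firstTwoRows n m) j      ≡⟨ sum-cong-≗ (colDeg-firstTwoRows n m) ⟩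
  ∑[ j < m ] 2                                ≡⟨ ∑-const m 2 ⟩
  m * 2                                       ∎
  where open ≡-Reasoning

firstTwoRows-degreeDominating : ∀ n m → 2 ≤ m → DegreeDominating (firstTwoRows n m)
firstTwoRows-degreeDominating n m 2≤m = degreeDominating-from-degrees R
  (λ i j → subst (2 ≤_) (cong (rowDeg R i +_) (sym (colDeg-firstTwoRows n m j))) (m≤n+m 2 (rowDeg R i)))
  cell
  where
  R : VSet (2 + n) m
  R = firstTwoRows n m
  cell : ∀ i j → R i j ≡ true → 4 ≤ rowDeg R i + colDeg R j
  cell i j i∈ = subst₂ (λ r c → 4 ≤ r + c) (sym (row-full i i∈)) (sym (colDeg-firstTwoRows n m j)) (+-monoˡ-≤ 2 2≤m)
    where
    row-full : ∀ i → R i j ≡ true → rowDeg R i ≡ m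
    row-full zero          _ = ∣∣-full m
    row-full (suc zero)    _ = ∣∣-full m

classCells : ∀ {n m} (o d : ℕ) .{{_ : NonZero d}} → VSet n m
classCells o d i j = inClass o d (toℕ j) (toℕ i)

count-classCells : ∀ {n m} o d .{{_ : NonZero d}} → count (classCells {n} {m} o d) ≤ n ∸ o
count-classCells {n} {m} o d = begin
  count C                    ≡⟨ count≡∑rowDeg C ⟩
  ∑[ i < n ] rowDeg C i      ≤⟨ ∑-mono-≤ row≤ ⟩
  ∑[ i < n ] χ (o ≤ᵇ toℕ i)  ≡⟨ ∣≤ᵇtoℕ∣ o ⟩
  n ∸ o                      ∎
  where
  open ≤-Reasoning
  C : VSet n m
  C = classCells o d
  row≤ : ∀ i → rowDeg C i ≤ χ (o ≤ᵇ toℕ i)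
  row≤ i with o ≤ᵇ toℕ i
  ... | true  = ∣≡ᵇtoℕ∣≤1 {m} ((toℕ i ∸ o) % d)
  ... | false = ≤-reflexive (∑-zero m)

-- Rows i < a are centres, meeting the columns j ≥ b with j − b ≡ i (mod a), at least three
-- of them. Every other row is a leaf with its single cell in column (i − a) mod max(b, 1);
-- these columns receive three leaves each (for b = 0: two leaves and centre row 0).
-- So every cell lies in a row or a column with at least three cells.
spread : ∀ {n m} (a b : ℕ) .{{_ : NonZero a}} → VSet n m
spread a b = classCells a (suc (pred b)) ∪ (classCells b a) ᵀ

module _ {n m : ℕ} (a : ℕ) .{{_ : NonZero a}} where

  spread-centreRow : ∀ b → b + 3 * a ≤ m → (i : Fin n) → toℕ i < a → 3 ≤ rowDeg (spread {n} {m} a b) i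
  spread-centreRow b b+3a≤m i i<a =
    ≤-trans (3≤∣class∣ b a i<a b+3a≤m)
      (∣∣-mono {m} {A = λ j → inClass b a (toℕ i) (toℕ j)} {B = spread a b i}
        (λ j → ∈∪ʳ (classCells a (suc (pred b))) (classCells b a ᵀ)))

  spread-centreCol : ∀ b → a + 3 * suc b ≤ n → (j : Fin m) → toℕ j < suc b → 3 ≤ colDeg (spread {n} {m} a (suc b)) j
  spread-centreCol b a+3b≤n j j<b =
    ≤-trans (3≤∣class∣ a (suc b) j<b a+3b≤n)
      (∣∣-mono {n} {A = λ i → inClass a (suc b) (toℕ j) (toℕ i)} {B = λ i → spread a (suc b) i j}
        (λ i → ∈∪ˡ (classCells a (suc b)) (classCells (suc b) a ᵀ)))

  spread-leafCol : ∀ b → a + 2 ≤ n → a + 3 * b ≤ n → (i : Fin n) (j : Fin m) →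
    classCells a (suc (pred b)) i j ≡ true → 3 ≤ colDeg (spread {n} {m} a b) j
  spread-leafCol (suc b) _ a+3b≤n i j ij∈ =
    spread-centreCol b a+3b≤n j (subst (_< suc b) (proj₂ (inClass-elim {a} {suc b} ij∈)) (m%n<n (toℕ i ∸ a) (suc b)))
  spread-leafCol zero a+2≤n _ i j ij∈ =
    3≤∣∣ (λ i → spread a 0 i j)
      (∈∪ʳ (classCells a 1) ((classCells 0 a) ᵀ) centre∈)
      (∈∪ˡ (classCells a 1) ((classCells 0 a) ᵀ) (leaf∈ 0 z≤n))
      (∈∪ˡ (classCells a 1) ((classCells 0 a) ᵀ) (leaf∈ 1 ≤-refl))
      (a+c≢0 ∘ fromℕ<-injective _ 0 (a+c<n 0 z≤n) 0<n)
      (a+c≢0 ∘ fromℕ<-injective _ 0 (a+c<n 1 ≤-refl) 0<n)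
      (a+0≢a+1 ∘ sym ∘ fromℕ<-injective _ _ (a+c<n 1 ≤-refl) (a+c<n 0 z≤n))
    where
    0<a : 0 < a
    0<a = >-nonZero⁻¹ a
    j≡0 : toℕ j ≡ 0
    j≡0 = trans (sym (proj₂ (inClass-elim {a} {1} ij∈))) (n%1≡0 (toℕ i ∸ a))
    a+c<n : ∀ c → c ≤ 1 → a + c < n
    a+c<n c c≤1 = ≤-trans (s≤s (+-monoʳ-≤ a c≤1)) (subst (_≤ n) (+-suc a 1) a+2≤n)
    0<n : 0 < n
    0<n = <-≤-trans 0<a (≤-trans (m≤m+n a 0) (<⇒≤ (a+c<n 0 z≤n)))
    a+c≢0 : ∀ {c} → ¬ a + c ≡ 0
    a+c≢0 {c} e = <⇒≢ (<-≤-trans 0<a (m≤m+n a c)) (sym e)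
    a+0≢a+1 : ¬ a + 0 ≡ a + 1
    a+0≢a+1 e = 0≢1+n (+-cancelˡ-≡ a 0 1 e)
    centre∈ : ((classCells 0 a) ᵀ) (fromℕ< 0<n) j ≡ true
    centre∈ = inClass-intro z≤n (trans (cong (_% a) j≡0) (trans (m<n⇒m%n≡m 0<a) (sym (toℕ-fromℕ< 0<n))))
    leaf∈ : ∀ c (c≤1 : c ≤ 1) → classCells a 1 (fromℕ< (a+c<n c c≤1)) j ≡ true
    leaf∈ c c≤1 = inClass-intro (subst (a ≤_) (sym (toℕ-fromℕ< (a+c<n c c≤1))) (m≤m+n a c))
                                (trans (n%1≡0 (toℕ (fromℕ< (a+c<n c c≤1)) ∸ a)) (sym j≡0))

  spread-rowDeg≥1 : ∀ b → 3 * a + b ≤ m → (i : Fin n) → 1 ≤ rowDeg (spread {n} {m} a b) i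
  spread-rowDeg≥1 b 3a+b≤m i with toℕ i <? a
  ... | yes i<a = ≤-trans (s≤s z≤n) (spread-centreRow b (subst (_≤ m) (+-comm (3 * a) b) 3a+b≤m) i i<a)
  ... | no  i≮a = 1≤∣∣ (spread a b i) (∈∪ˡ (classCells a (suc (pred b))) (classCells b a ᵀ) leaf∈)
    where
    b′≤m : suc (pred b) ≤ m
    b′≤m = ≤-trans (s≤s pred[n]≤n)
             (≤-trans (+-monoˡ-≤ b (≤-trans (>-nonZero⁻¹ a) (m≤m+n a (2 * a)))) 3a+b≤m)
    column< : (toℕ i ∸ a) % suc (pred b) < m
    column< = <-≤-trans (m%n<n (toℕ i ∸ a) (suc (pred b))) b′≤m
    leaf∈ : classCells a (suc (pred b)) i (fromℕ< column<) ≡ true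
    leaf∈ = inClass-intro (≮⇒≥ i≮a) (sym (toℕ-fromℕ< column<))

  spread-colDeg≥1 : ∀ b → a + 3 * b ≤ n → (j : Fin m) → 1 ≤ colDeg (spread {n} {m} a b) j
  spread-colDeg≥1 b a+3b≤n j with toℕ j <? b
  spread-colDeg≥1 (suc b) a+3b≤n j | yes j<b = ≤-trans (s≤s z≤n) (spread-centreCol b a+3b≤n j j<b)
  ... | no j≮b = 1≤∣∣ (λ i → spread a b i j) (∈∪ʳ (classCells a (suc (pred b))) (classCells b a ᵀ) centre∈)
    where
    row< : (toℕ j ∸ b) % a < n
    row< = <-≤-trans (m%n<n (toℕ j ∸ b) a) (≤-trans (m≤m+n a (3 * b)) a+3b≤n)
    centre∈ : (classCells b a ᵀ) (fromℕ< row<) j ≡ true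
    centre∈ = inClass-intro (≮⇒≥ j≮b) (sym (toℕ-fromℕ< row<))

  spread-degreeDominating : ∀ b → a + 2 ≤ n → a + 3 * b ≤ n → 3 * a + b ≤ m →
    DegreeDominating (spread {n} {m} a b)
  spread-degreeDominating b a+2≤n a+3b≤n 3a+b≤m = degreeDominating-from-degrees P
    (λ i j → +-mono-≤ (spread-rowDeg≥1 b 3a+b≤m i) (spread-colDeg≥1 b a+3b≤n j))
    cell
    where
    P : VSet n m
    P = spread a b
    cell : ∀ i j → P i j ≡ true → 4 ≤ rowDeg P i + colDeg P j
    cell i j ij∈ with ∨-true ij∈
    ... | inj₁ leaf∈   = +-mono-≤ (spread-rowDeg≥1 b 3a+b≤m i) (spread-leafCol b a+2≤n a+3b≤n i j leaf∈)
    ... | inj₂ centre∈ = +-mono-≤ (spread-centreRow b (subst (_≤ m) (+-comm (3 * a) b) 3a+b≤m) i i<a)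
                                  (spread-colDeg≥1 b a+3b≤n j)
      where
      i<a : toℕ i < a
      i<a = subst (_< a) (proj₂ (inClass-elim {b} {a} centre∈)) (m%n<n (toℕ j ∸ b) a)

  spread-count : ∀ b → a ≤ n → b ≤ m → count (spread {n} {m} a b) + (a + b) ≤ n + m
  spread-count b a≤n b≤m = begin
    count (spread {n} {m} a b) + (a + b)  ≤⟨ +-monoˡ-≤ (a + b) parts ⟩
    (n ∸ a) + (m ∸ b) + (a + b)           ≡⟨ regroup (n ∸ a) (m ∸ b) a b ⟩
    (n ∸ a + a) + (m ∸ b + b)             ≡⟨ cong₂ _+_ (m∸n+n≡m a≤n) (m∸n+n≡m b≤m) ⟩
    n + m                                 ∎
    where
    open ≤-Reasoning
    regroup : ∀ x y a b → x + y + (a + b) ≡ (x + a) + (y + b)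
    regroup = solve-∀
    parts : count (spread {n} {m} a b) ≤ (n ∸ a) + (m ∸ b)
    parts = ≤-trans (count-∪ {n} {m} (classCells a (suc (pred b))) (classCells b a ᵀ))
      (+-mono-≤ (count-classCells {n} {m} a (suc (pred b)))
                (≤-trans (≤-reflexive (count-ᵀ (classCells {m} {n} b a))) (count-classCells {m} {n} b a)))

module _ {n m n′ m′} (S : VSet n m) (U : VSet n′ m′) where

  block : Fin n ⊎ Fin n′ → Fin m ⊎ Fin m′ → Bool
  block (inj₁ u) (inj₁ v) = S u v
  block (inj₁ _) (inj₂ _) = false
  block (inj₂ _) (inj₁ _) = false
  block (inj₂ p) (inj₂ q) = U p q

  _⊕_ : VSet (n + n′) (m + m′)
  _⊕_ i j = block (splitAt n i) (splitAt m j)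

  blockRowDeg : Fin n ⊎ Fin n′ → ℕ
  blockRowDeg = [ rowDeg S , rowDeg U ]′

  blockColDeg : Fin m ⊎ Fin m′ → ℕ
  blockColDeg = [ colDeg S , colDeg U ]′

  rowDeg-⊕ : ∀ i → rowDeg _⊕_ i ≡ blockRowDeg (splitAt n i)
  rowDeg-⊕ i = trans (∑-↑ m m′ _) (row (splitAt n i))
    where
    row : ∀ s → ∑[ v < m ] χ (block s (splitAt m (v ↑ˡ m′))) + ∑[ q < m′ ] χ (block s (splitAt m (m ↑ʳ q)))
              ≡ blockRowDeg s
    row s = trans (cong₂ _+_ (sum-cong-≗ (λ v → cong (χ ∘ block s) (splitAt-↑ˡ m v m′)))
                             (sum-cong-≗ (λ q → cong (χ ∘ block s) (splitAt-↑ʳ m m′ q))))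
                  (split s)
      where
      split : ∀ s → ∑[ v < m ] χ (block s (inj₁ v)) + ∑[ q < m′ ] χ (block s (inj₂ q)) ≡ blockRowDeg s
      split (inj₁ u) = trans (cong (rowDeg S u +_) (∑-zero m′)) (+-identityʳ (rowDeg S u))
      split (inj₂ p) = cong (_+ rowDeg U p) (∑-zero m)

module _ {n m n′ m′} (S : VSet n m) (U : VSet n′ m′) where

  ⊕-ᵀ : ∀ j i → ((S ⊕ U) ᵀ) j i ≡ ((S ᵀ) ⊕ (U ᵀ)) j i
  ⊕-ᵀ j i with splitAt n i | splitAt m j
  ... | inj₁ _ | inj₁ _ = refl
  ... | inj₁ _ | inj₂ _ = refl
  ... | inj₂ _ | inj₁ _ = refl
  ... | inj₂ _ | inj₂ _ = refl

  colDeg-⊕ : ∀ j → colDeg (S ⊕ U) j ≡ blockColDeg S U (splitAt m j)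
  colDeg-⊕ j = trans (sum-cong-≗ (cong χ ∘ ⊕-ᵀ j)) (rowDeg-⊕ (S ᵀ) (U ᵀ) j)

  count-⊕ : count (S ⊕ U) ≡ count S + count U
  count-⊕ = begin
    count (S ⊕ U)                                       ≡⟨ count≡∑rowDeg (S ⊕ U) ⟩
    ∑[ i < n + n′ ] rowDeg (S ⊕ U) i                    ≡⟨ sum-cong-≗ (rowDeg-⊕ S U) ⟩
    ∑[ i < n + n′ ] blockRowDeg S U (splitAt n i)       ≡⟨ ∑-↑ n n′ _ ⟩
    ∑[ u < n ] blockRowDeg S U (splitAt n (u ↑ˡ n′)) + ∑[ p < n′ ] blockRowDeg S U (splitAt n (n ↑ʳ p))
      ≡⟨ cong₂ _+_ (sum-cong-≗ (λ u → cong (blockRowDeg S U) (splitAt-↑ˡ n u n′)))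
                   (sum-cong-≗ (λ p → cong (blockRowDeg S U) (splitAt-↑ʳ n n′ p))) ⟩
    ∑[ u < n ] rowDeg S u + ∑[ p < n′ ] rowDeg U p     ≡⟨ cong₂ _+_ (count≡∑rowDeg S) (count≡∑rowDeg U) ⟨
    count S + count U                                   ∎
    where open ≡-Reasoning

  degreeDominating-⊕ : DegreeDominating S → DegreeDominating U →
    (∀ u → 1 ≤ rowDeg S u) → (∀ v → 1 ≤ colDeg S v) → (∀ p → 1 ≤ rowDeg U p) → (∀ q → 1 ≤ colDeg U q) →
    DegreeDominating (S ⊕ U)
  degreeDominating-⊕ domS domU rowS colS rowU colU i j =
    subst₂ (λ r c → 2 + 2 * χ ((S ⊕ U) i j) ≤ r + c) (sym (rowDeg-⊕ S U i)) (sym (colDeg-⊕ j))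
      (blocks (splitAt n i) (splitAt m j))
    where
    blocks : ∀ s t → 2 + 2 * χ (block S U s t) ≤ blockRowDeg S U s + blockColDeg S U t
    blocks (inj₁ u) (inj₁ v) = domS u v
    blocks (inj₁ u) (inj₂ q) = +-mono-≤ (rowS u) (colU q)
    blocks (inj₂ p) (inj₁ v) = +-mono-≤ (rowU p) (colS v)
    blocks (inj₂ p) (inj₂ q) = domU p q

star : VSet 4 4
star zero    zero    = false
star zero    (suc _) = true
star (suc _) zero    = true
star (suc _) (suc _) = false

star-degreeDominating : DegreeDominating star
star-degreeDominating zero    zero    = s≤s (s≤s z≤n)
star-degreeDominating zero    (suc _) = ≤-refl
star-degreeDominating (suc _) zero    = ≤-refl
star-degreeDominating (suc _) (suc _) = ≤-refl

star-rowDeg≥1 : ∀ p → 1 ≤ rowDeg star p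
star-rowDeg≥1 zero    = s≤s z≤n
star-rowDeg≥1 (suc _) = ≤-refl

star-colDeg≥1 : ∀ q → 1 ≤ colDeg star q
star-colDeg≥1 zero    = s≤s z≤n
star-colDeg≥1 (suc _) = ≤-refl

-- Upper bounds for γ_{2t}(K_n □ K_m)

LowerBound : ℕ → ℕ → ℕ → Set
LowerBound n m c = ∀ (T : VSet n m) → DegreeDominating T → c ≤ count T

LowerBound-ᵀ : ∀ {n m c} → LowerBound n m c → LowerBound m n c
LowerBound-ᵀ {c = c} bound T dom = subst (c ≤_) (count-ᵀ T) (bound (T ᵀ) (DegreeDominating-ᵀ T dom))

lowerBound≤m+m : ∀ {n m c} → 2 ≤ n → 2 ≤ m → LowerBound n m c → c ≤ m + m
lowerBound≤m+m {suc (suc n)} {m} {c} (s≤s (s≤s _)) 2≤m bound =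
  subst (c ≤_) (trans (count-firstTwoRows n m) (m*2≡m+m m))
        (bound (firstTwoRows n m) (firstTwoRows-degreeDominating n m 2≤m))
  where
  m*2≡m+m : ∀ m → m * 2 ≡ m + m
  m*2≡m+m = solve-∀

lowerBound≤n+n : ∀ {n m c} → 2 ≤ n → 2 ≤ m → LowerBound n m c → c ≤ n + n
lowerBound≤n+n 2≤n 2≤m bound = lowerBound≤m+m 2≤m 2≤n (LowerBound-ᵀ bound)

SpreadBound : ℕ → ℕ → ℕ → Set
SpreadBound n m c = ∀ a b → a + 3 * b ≤ n → 3 * a + b ≤ m → c + (a + b) ≤ n + m

SpreadBound-swap : ∀ {n m c} → SpreadBound n m c → SpreadBound m n c
SpreadBound-swap {n} {m} {c} bound a b a+3b≤m 3a+b≤n =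
  subst₂ (λ x y → c + x ≤ y) (+-comm b a) (+-comm n m)
    (bound b a (subst (_≤ n) (+-comm (3 * a) b) 3a+b≤n) (subst (_≤ m) (+-comm a (3 * b)) a+3b≤m))

lowerBound⇒spreadBound-suc : ∀ {n m c} → 2 ≤ n → 2 ≤ m → LowerBound n m c →
  ∀ a b → suc a + 3 * b ≤ n → 3 * suc a + b ≤ m → c + (suc a + b) ≤ n + m
lowerBound⇒spreadBound-suc {n} {m} {c} 2≤n 2≤m bound a b a+3b≤n 3a+b≤m with suc a + 2 ≤? n
... | yes a+2≤n = begin
  c + (suc a + b)                        ≤⟨ +-monoˡ-≤ (suc a + b) (bound (spread (suc a) b)
                                              (spread-degreeDominating (suc a) b a+2≤n a+3b≤n 3a+b≤m)) ⟩
  count (spread {n} {m} (suc a) b) + (suc a + b) ≤⟨ spread-count (suc a) b a≤n b≤m ⟩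
  n + m                                  ∎
  where
  open ≤-Reasoning
  a≤n : suc a ≤ n
  a≤n = ≤-trans (m≤m+n (suc a) (3 * b)) a+3b≤n
  b≤m : b ≤ m
  b≤m = ≤-trans (m≤n+m b (3 * suc a)) 3a+b≤m
lowerBound⇒spreadBound-suc {n} {m} {c} 2≤n 2≤m bound a (suc b) a+3b≤n 3a+b≤m | no a+2≰n =
  ⊥-elim (a+2≰n (≤-trans (+≡⇒≤ (1 + 3 * b) (a+2+[1+3b] a b)) a+3b≤n))
  where
  a+2+[1+3b] : ∀ a b → suc a + 2 + (1 + 3 * b) ≡ suc a + 3 * suc b
  a+2+[1+3b] = solve-∀
lowerBound⇒spreadBound-suc {n} {m} {c} 2≤n 2≤m bound a zero _ 3a≤m | no a+2≰n = begin
  c + (suc a + 0)              ≤⟨ +-monoˡ-≤ (suc a + 0) (lowerBound≤n+n 2≤n 2≤m bound) ⟩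
  n + n + (suc a + 0)          ≡⟨ +-assoc n n (suc a + 0) ⟩
  n + (n + (suc a + 0))        ≤⟨ +-monoʳ-≤ n (+-monoˡ-≤ (suc a + 0) n≤a+1) ⟩
  n + (suc a + 1 + (suc a + 0)) ≤⟨ +-monoʳ-≤ n (+≡⇒≤ a (2a+3+a a)) ⟩
  n + (3 * suc a + 0)          ≤⟨ +-monoʳ-≤ n 3a≤m ⟩
  n + m                        ∎
  where
  open ≤-Reasoning
  n≤a+1 : n ≤ suc a + 1
  n≤a+1 = ≤-pred (subst (n <_) (+-suc (suc a) 1) (≰⇒> a+2≰n))
  2a+3+a : ∀ a → suc a + 1 + (suc a + 0) + a ≡ 3 * suc a + 0
  2a+3+a = solve-∀

lowerBound⇒spreadBound : ∀ {n m c} → 2 ≤ n → 2 ≤ m → LowerBound n m c → SpreadBound n m c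
lowerBound⇒spreadBound {n} {m} {c} 2≤n 2≤m bound zero zero _ _ with ≤-total n m
... | inj₁ n≤m = ≤-trans (≤-reflexive (+-identityʳ c)) (≤-trans (lowerBound≤n+n 2≤n 2≤m bound) (+-monoʳ-≤ n n≤m))
... | inj₂ m≤n = ≤-trans (≤-reflexive (+-identityʳ c)) (≤-trans (lowerBound≤m+m 2≤n 2≤m bound) (+-monoˡ-≤ m m≤n))
lowerBound⇒spreadBound 2≤n 2≤m bound (suc a) b = lowerBound⇒spreadBound-suc 2≤n 2≤m bound a b
lowerBound⇒spreadBound {n} {m} {c} 2≤n 2≤m bound zero (suc b) 3b≤n b≤m =
  subst₂ (λ x y → c + x ≤ y) (+-identityʳ (suc b)) (+-comm m n)
    (lowerBound⇒spreadBound-suc 2≤m 2≤n (LowerBound-ᵀ bound) b 0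
      (subst (_≤ m) (sym (+-identityʳ (suc b))) b≤m) (subst (_≤ n) (sym (+-identityʳ (3 * suc b))) 3b≤n))

-- Leaves and deficits

≡ᵇ-true : ∀ {x y} → (x ≡ᵇ y) ≡ true → x ≡ y
≡ᵇ-true {x} {y} e = ≡ᵇ⇒≡ x y (Equivalence.from T-≡ e)

≡ᵇ-false : ∀ {x y} → (x ≡ᵇ y) ≡ false → ¬ x ≡ y
≡ᵇ-false {x} {y} e x≡y = subst T e (≡⇒≡ᵇ x y x≡y)

shortfall+χ≤ : ∀ L P → ¬ L + P ≡ 1 → 1 ≤ L + P → (1 ≤ L → 3 ≤ L + P) → (2 ∸ P) + χ (1 ≤ᵇ (2 ∸ P)) ≤ L
shortfall+χ≤ L zero _ 1≤L+0 3≤L+0 =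
  subst (3 ≤_) (+-identityʳ L) (3≤L+0 (subst (1 ≤_) (+-identityʳ L) 1≤L+0))
shortfall+χ≤ zero          (suc zero) L+1≢1 _ _ = ⊥-elim (L+1≢1 refl)
shortfall+χ≤ (suc L)       (suc zero) _ _ 3≤L+1 = +-cancelʳ-≤ 1 2 (suc L) (3≤L+1 (s≤s z≤n))
shortfall+χ≤ L (suc (suc P)) _ _ _ rewrite 0∸n≡0 P = z≤n

≤2⇒≤χ+χ : ∀ x → x ≤ 2 → x ≤ χ (1 ≤ᵇ x) + χ (1 ≤ᵇ x)
≤2⇒≤χ+χ zero                _ = z≤n
≤2⇒≤χ+χ (suc zero)          _ = s≤s z≤n
≤2⇒≤χ+χ (suc (suc zero))    _ = ≤-refl
≤2⇒≤χ+χ (suc (suc (suc _))) (s≤s (s≤s ()))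

module Leaves {N M} (T : VSet N M) (dom : DegreeDominating T) where

  leafRow : Fin N → Bool
  leafRow i = rowDeg T i ≡ᵇ 1

  leafCol : Fin M → Bool
  leafCol j = colDeg T j ≡ᵇ 1

  leafColCells : Fin N → ℕ
  leafColCells i = ∣ (λ j → leafCol j ∧ T i j) ∣

  innerCells : Fin N → ℕ
  innerCells i = ∣ (λ j → not (leafCol j) ∧ T i j) ∣

  deficit : Fin N → ℕ
  deficit i = if leafRow i then 0 else 2 ∸ innerCells i

  deficient : Fin N → Bool
  deficient i = 1 ≤ᵇ deficit i

  rowDeg≡ : ∀ i → rowDeg T i ≡ leafColCells i + innerCells i
  rowDeg≡ i = trans (sum-cong-≗ split) (∑-distrib-+ (λ j → χ (leafCol j ∧ T i j)) (λ j → χ (not (leafCol j) ∧ T i j)))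
    where
    split : ∀ j → χ (T i j) ≡ χ (leafCol j ∧ T i j) + χ (not (leafCol j) ∧ T i j)
    split j with leafCol j
    ... | true  = sym (+-identityʳ _)
    ... | false = refl

  leafCol-cell⇒3≤rowDeg : ∀ {i j} → leafCol j ≡ true → T i j ≡ true → 3 ≤ rowDeg T i
  leafCol-cell⇒3≤rowDeg {i} {j} leaf ij∈T = +-cancelʳ-≤ 1 3 (rowDeg T i)
    (subst₂ (λ b c → 2 + 2 * χ b ≤ rowDeg T i + c) ij∈T (≡ᵇ-true leaf) (dom i j))

  leafRow⇒leafColCells≡0 : ∀ {i} → leafRow i ≡ true → leafColCells i ≡ 0
  leafRow⇒leafColCells≡0 {i} leaf with leafColCells i in eq
  ... | zero  = refl
  ... | suc _ with ∣∣≥1⇒∈ (λ j → leafCol j ∧ T i j) (subst (1 ≤_) (sym eq) (s≤s z≤n))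
  ...   | j , j∈ with leafCol j in leafJ
  ...     | true  = ⊥-elim (3≰1 (subst (3 ≤_) (≡ᵇ-true leaf) (leafCol-cell⇒3≤rowDeg leafJ j∈)))
    where
    3≰1 : ¬ 3 ≤ 1
    3≰1 (s≤s ())

  row-bound : ∀ i → 1 + χ (not (leafRow i)) + leafColCells i ≤ rowDeg T i + deficit i
  row-bound i with leafRow i in leaf
  ... | true  = begin
    1 + leafColCells i  ≡⟨ cong suc (leafRow⇒leafColCells≡0 leaf) ⟩
    1                   ≡⟨ ≡ᵇ-true leaf ⟨
    rowDeg T i          ≤⟨ m≤m+n (rowDeg T i) 0 ⟩
    rowDeg T i + 0      ∎
    where open ≤-Reasoning
  ... | false = begin
    2 + leafColCells i                                ≡⟨ +-comm 2 (leafColCells i) ⟩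
    leafColCells i + 2                                ≤⟨ +-monoʳ-≤ (leafColCells i) (m≤n+m∸n 2 (innerCells i)) ⟩
    leafColCells i + (innerCells i + (2 ∸ innerCells i)) ≡⟨ +-assoc (leafColCells i) _ _ ⟨
    leafColCells i + innerCells i + (2 ∸ innerCells i) ≡⟨ cong (_+ (2 ∸ innerCells i)) (rowDeg≡ i) ⟨
    rowDeg T i + (2 ∸ innerCells i)                   ∎
    where open ≤-Reasoning

  deficit-bound : (∀ i → 1 ≤ rowDeg T i) → ∀ i → deficit i + χ (deficient i) ≤ leafColCells i
  deficit-bound 1≤rowDeg i with leafRow i in leaf
  ... | true  = z≤n
  ... | false = shortfall+χ≤ (leafColCells i) (innerCells i)
    (≡ᵇ-false leaf ∘ trans (rowDeg≡ i))
    (subst (1 ≤_) (rowDeg≡ i) (1≤rowDeg i))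
    (λ 1≤L → subst (3 ≤_) (rowDeg≡ i) (some-leafCol-cell 1≤L))
    where
    some-leafCol-cell : 1 ≤ leafColCells i → 3 ≤ rowDeg T i
    some-leafCol-cell 1≤L with ∣∣≥1⇒∈ (λ j → leafCol j ∧ T i j) 1≤L
    ... | j , j∈ with leafCol j in leafJ
    ...   | true = leafCol-cell⇒3≤rowDeg leafJ j∈

  deficit≤χ+χ : ∀ i → deficit i ≤ χ (deficient i) + χ (deficient i)
  deficit≤χ+χ i = ≤2⇒≤χ+χ (deficit i) (deficit≤2 i)
    where
    deficit≤2 : ∀ i → deficit i ≤ 2
    deficit≤2 i with leafRow i
    ... | true  = z≤n
    ... | false = m∸n≤m 2 (innerCells i)

  deficient⇒nonLeaf : ∀ i → χ (deficient i) ≤ χ (not (leafRow i))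
  deficient⇒nonLeaf i with leafRow i
  ... | true  = z≤n
  ... | false = χ≤1 (1 ≤ᵇ (2 ∸ innerCells i))

  ∑leafColCells≡∣leafCol∣ : ∑[ i < N ] leafColCells i ≡ ∣ leafCol ∣
  ∑leafColCells≡∣leafCol∣ = trans (∑-comm (λ i j → χ (leafCol j ∧ T i j))) (sum-cong-≗ column)
    where
    column : ∀ j → ∑[ i < N ] χ (leafCol j ∧ T i j) ≡ χ (leafCol j)
    column j with leafCol j in leaf
    ... | true  = ≡ᵇ-true leaf
    ... | false = ∑-zero N

  totalDeficit : ℕ
  totalDeficit = ∑[ i < N ] deficit i

  ∑-row-bound : N + ∣ not ∘ leafRow ∣ + ∣ leafCol ∣ ≤ count T + totalDeficit
  ∑-row-bound = begin
    N + ∣ not ∘ leafRow ∣ + ∣ leafCol ∣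
      ≡⟨ cong₂ (λ x y → x + ∣ not ∘ leafRow ∣ + y) (∣∣-full N) ∑leafColCells≡∣leafCol∣ ⟨
    ∑[ i < N ] 1 + ∣ not ∘ leafRow ∣ + ∑[ i < N ] leafColCells i
      ≡⟨ cong (_+ ∑[ i < N ] leafColCells i) (∑-distrib-+ (λ _ → 1) (χ ∘ not ∘ leafRow)) ⟨
    ∑[ i < N ] (1 + χ (not (leafRow i))) + ∑[ i < N ] leafColCells i
      ≡⟨ ∑-distrib-+ (λ i → 1 + χ (not (leafRow i))) leafColCells ⟨
    ∑[ i < N ] (1 + χ (not (leafRow i)) + leafColCells i)
      ≤⟨ ∑-mono-≤ row-bound ⟩
    ∑[ i < N ] (rowDeg T i + deficit i)
      ≡⟨ ∑-distrib-+ (rowDeg T) deficit ⟩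
    ∑[ i < N ] rowDeg T i + totalDeficit
      ≡⟨ cong (_+ totalDeficit) (count≡∑rowDeg T) ⟨
    count T + totalDeficit ∎
    where open ≤-Reasoning

  totalDeficit+∣deficient∣≤∣leafCol∣ : (∀ i → 1 ≤ rowDeg T i) → totalDeficit + ∣ deficient ∣ ≤ ∣ leafCol ∣
  totalDeficit+∣deficient∣≤∣leafCol∣ 1≤rowDeg = begin
    totalDeficit + ∣ deficient ∣              ≡⟨ ∑-distrib-+ deficit (χ ∘ deficient) ⟨
    ∑[ i < N ] (deficit i + χ (deficient i))  ≤⟨ ∑-mono-≤ (deficit-bound 1≤rowDeg) ⟩
    ∑[ i < N ] leafColCells i                 ≡⟨ ∑leafColCells≡∣leafCol∣ ⟩
    ∣ leafCol ∣                               ∎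
    where open ≤-Reasoning

  totalDeficit≤2∣deficient∣ : totalDeficit ≤ ∣ deficient ∣ + ∣ deficient ∣
  totalDeficit≤2∣deficient∣ =
    ≤-trans (∑-mono-≤ deficit≤χ+χ) (≤-reflexive (∑-distrib-+ (χ ∘ deficient) (χ ∘ deficient)))

  ∣deficient∣≤∣nonLeaf∣ : ∣ deficient ∣ ≤ ∣ not ∘ leafRow ∣
  ∣deficient∣≤∣nonLeaf∣ = ∑-mono-≤ deficient⇒nonLeaf

record DeficitBounds (N M t : ℕ) : Set where
  field
    rowDeficit colDeficit deficientRows deficientCols : ℕ
    size≥   : (N + M) + (N + M) ≤ (t + t) + (rowDeficit + colDeficit)
    M≥      : rowDeficit + deficientRows + deficientCols ≤ M
    N≥      : colDeficit + deficientCols + deficientRows ≤ N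
    rowDeficit≤ : rowDeficit ≤ deficientRows + deficientRows
    colDeficit≤ : colDeficit ≤ deficientCols + deficientCols

deficitBounds : ∀ {N M} (T : VSet N M) → DegreeDominating T →
  (∀ i → 1 ≤ rowDeg T i) → (∀ j → 1 ≤ colDeg T j) → DeficitBounds N M (count T)
deficitBounds {N} {M} T dom 1≤rowDeg 1≤colDeg = record
  { rowDeficit    = R.totalDeficit
  ; colDeficit    = C.totalDeficit
  ; deficientRows = ∣ R.deficient ∣
  ; deficientCols = ∣ C.deficient ∣
  ; size≥ = begin
      (N + M) + (N + M)
        ≡⟨ cong₂ (λ x y → (N + M) + (x + y)) (∣∣+∣∁∣ R.leafRow) (∣∣+∣∁∣ R.leafCol) ⟨
      (N + M) + ((∣ R.leafRow ∣ + ∣ not ∘ R.leafRow ∣) + (∣ R.leafCol ∣ + ∣ not ∘ R.leafCol ∣))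
        ≡⟨ regroup N M (∣ R.leafRow ∣) (∣ not ∘ R.leafRow ∣) (∣ R.leafCol ∣) (∣ not ∘ R.leafCol ∣) ⟩
      (N + ∣ not ∘ R.leafRow ∣ + ∣ R.leafCol ∣) + (M + ∣ not ∘ R.leafCol ∣ + ∣ R.leafRow ∣)
        ≤⟨ +-mono-≤ R.∑-row-bound C.∑-row-bound ⟩
      (count T + R.totalDeficit) + (count (T ᵀ) + C.totalDeficit)
        ≡⟨ cong (λ t′ → (count T + R.totalDeficit) + (t′ + C.totalDeficit)) (count-ᵀ T) ⟩
      (count T + R.totalDeficit) + (count T + C.totalDeficit)
        ≡⟨ +-comm-middle (count T) R.totalDeficit (count T) C.totalDeficit ⟩
      (count T + count T) + (R.totalDeficit + C.totalDeficit) ∎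
  ; M≥ = ≤-trans (+-mono-≤ (R.totalDeficit+∣deficient∣≤∣leafCol∣ 1≤rowDeg) C.∣deficient∣≤∣nonLeaf∣)
                 (≤-reflexive (∣∣+∣∁∣ R.leafCol))
  ; N≥ = ≤-trans (+-mono-≤ (C.totalDeficit+∣deficient∣≤∣leafCol∣ 1≤colDeg) R.∣deficient∣≤∣nonLeaf∣)
                 (≤-reflexive (∣∣+∣∁∣ R.leafRow))
  ; rowDeficit≤ = R.totalDeficit≤2∣deficient∣
  ; colDeficit≤ = C.totalDeficit≤2∣deficient∣
  }
  where
  module R = Leaves T dom
  module C = Leaves (T ᵀ) (DegreeDominating-ᵀ T dom)
  open ≤-Reasoning
  regroup : ∀ N M lr nlr lc nlc → (N + M) + ((lr + nlr) + (lc + nlc)) ≡ (N + nlr + lc) + (M + nlc + lr)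
  regroup = solve-∀
  +-comm-middle : ∀ a b c d → (a + b) + (c + d) ≡ (a + c) + (b + d)
  +-comm-middle = solve-∀

-- Arithmetic of the lower bound

parity : ∀ D → ∃[ A ] ∃[ p ] (p ≤ 1 × D ≡ A + A + p)
parity zero = 0 , 0 , z≤n , refl
parity (suc D) with parity D
... | A , zero     , _ , refl = A , 1 , ≤-refl , even+1 A
  where
  even+1 : ∀ A → suc (A + A + 0) ≡ A + A + 1
  even+1 = solve-∀
... | A , suc zero , _ , refl = suc A , 0 , z≤n , odd+1 A
  where
  odd+1 : ∀ A → suc (A + A + 1) ≡ suc A + suc A + 0
  odd+1 = solve-∀
... | _ , suc (suc _) , s≤s () , _

halve : ∀ D x → D ≤ x + x → ∃[ A ] ∃[ p ] (p ≤ 1 × D ≡ A + A + p × A + p ≤ x)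
halve D x D≤2x with parity D
... | A , p , p≤1 , refl = A , p , p≤1 , refl , A+p≤x
  where
  A+p≤x : A + p ≤ x
  A+p≤x with A + p ≤? x
  ... | yes ≤x = ≤x
  ... | no  ≰x = ⊥-elim (2≰1 (≤-trans 2≤p p≤1))
    where
    open ≤-Reasoning
    2≰1 : ¬ 2 ≤ 1
    2≰1 (s≤s ())
    twice-suc : ∀ x → x + x + 2 ≡ suc x + suc x
    twice-suc = solve-∀
    twice-+ : ∀ A p → (A + p) + (A + p) ≡ A + A + p + p
    twice-+ = solve-∀
    2≤p : 2 ≤ p
    2≤p = +-cancelˡ-≤ (A + A + p) 2 p (begin
      A + A + p + 2       ≤⟨ +-monoˡ-≤ 2 D≤2x ⟩
      x + x + 2           ≡⟨ twice-suc x ⟩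
      suc x + suc x       ≤⟨ +-mono-≤ (≰⇒> ≰x) (≰⇒> ≰x) ⟩
      (A + p) + (A + p)   ≡⟨ twice-+ A p ⟩
      A + A + p + p       ∎)

spreadBound-odd : ∀ {n m c} → SpreadBound n m c →
  ∀ A B → 3 * A + B ≤ m + 1 → A + 3 * B ≤ n + 1 → c + (A + B) ≤ n + m + 1
spreadBound-odd {n} {m} {c} bound A (suc B) hM hN =
  ≤-extend 1 (shift c A B) refl
    (bound A B (≤-reduce 2 1 (3[1+B] A B) refl hN) (≤-reduce 0 1 (1+B A B) refl hM))
  where
  shift : ∀ c A B → c + (A + B) + 1 ≡ c + (A + suc B)
  shift = solve-∀
  3[1+B] : ∀ A B → A + 3 * suc B ≡ A + 3 * B + 2 + 1
  3[1+B] = solve-∀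
  1+B : ∀ A B → 3 * A + suc B ≡ 3 * A + B + 0 + 1
  1+B = solve-∀
spreadBound-odd {n} {m} {c} bound (suc A) zero hM hN =
  ≤-extend 1 (shift c A) refl (bound A 0 (≤-reduce 0 1 (1+A A) refl hN) (≤-reduce 2 1 (3[1+A] A) refl hM))
  where
  shift : ∀ c A → c + (A + 0) + 1 ≡ c + (suc A + 0)
  shift = solve-∀
  1+A : ∀ A → suc A + 3 * 0 ≡ A + 3 * 0 + 0 + 1
  1+A = solve-∀
  3[1+A] : ∀ A → 3 * suc A + 0 ≡ 3 * A + 0 + 2 + 1
  3[1+A] = solve-∀
spreadBound-odd {n} {m} {c} bound zero zero _ _ = ≤-trans (bound 0 0 z≤n z≤n) (m≤m+n (n + m) 1)

spreadBound-oneSided : ∀ {n m c} → SpreadBound n m c → c ≤ n + n →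
  ∀ A → 3 * A ≤ m + 4 → c + A ≤ n + m + 2
spreadBound-oneSided {n} {m} {c} bound c≤2n zero _ =
  ≤-trans (bound 0 0 z≤n z≤n) (m≤m+n (n + m) 2)
spreadBound-oneSided {n} {m} {c} bound c≤2n (suc zero) _ =
  ≤-trans (+-monoʳ-≤ c (s≤s z≤n)) (≤-extend 2 (cong (_+ 2) (+-identityʳ c)) refl (bound 0 0 z≤n z≤n))
spreadBound-oneSided {n} {m} {c} bound c≤2n (suc (suc A)) 3A≤m+4 with A ≤? n
... | yes A≤n = ≤-extend 2 (shift c A) refl
  (bound A 0 (subst (_≤ n) (sym (+-identityʳ A)) A≤n) (≤-reduce 2 4 (3[2+A] A) refl 3A≤m+4))
  where
  shift : ∀ c A → c + (A + 0) + 2 ≡ c + suc (suc A)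
  shift = solve-∀
  3[2+A] : ∀ A → 3 * suc (suc A) ≡ 3 * A + 0 + 2 + 4
  3[2+A] = solve-∀
... | no A≰n = begin
  c + suc (suc A)          ≤⟨ +-monoˡ-≤ (suc (suc A)) c≤2n ⟩
  n + n + suc (suc A)      ≡⟨ +-assoc n n (suc (suc A)) ⟩
  n + (n + suc (suc A))    ≤⟨ +-monoʳ-≤ n n+A≤m+2 ⟩
  n + (m + 2)              ≡⟨ +-assoc n m 2 ⟨
  n + m + 2                ∎
  where
  open ≤-Reasoning
  lhs : ∀ n A → suc n + 3 * suc (suc A) ≡ n + suc (suc A) + (A + 3) + (A + 2)
  lhs = solve-∀
  rhs : ∀ m A → A + (m + 4) ≡ m + 2 + (A + 2)
  rhs = solve-∀
  n+A≤m+2 : n + suc (suc A) ≤ m + 2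
  n+A≤m+2 = ≤-reduce (A + 3) (A + 2) (lhs n A) (rhs m A) (+-mono-≤ (≰⇒> A≰n) 3A≤m+4)

spreadBound-even : ∀ {n m c} → SpreadBound n m c → c ≤ n + n → c ≤ m + m →
  ∀ A B → 3 * A + B ≤ m + 4 → A + 3 * B ≤ n + 4 → c + (A + B) ≤ n + m + 2
spreadBound-even {n} {m} {c} bound _ _ (suc A) (suc B) hM hN =
  ≤-extend 2 (shift c A B) refl (bound A B (≤-reduce 0 4 (eqN A B) refl hN) (≤-reduce 0 4 (eqM A B) refl hM))
  where
  shift : ∀ c A B → c + (A + B) + 2 ≡ c + (suc A + suc B)
  shift = solve-∀
  eqN : ∀ A B → suc A + 3 * suc B ≡ A + 3 * B + 0 + 4
  eqN = solve-∀
  eqM : ∀ A B → 3 * suc A + suc B ≡ 3 * A + B + 0 + 4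
  eqM = solve-∀
spreadBound-even {n} {m} {c} bound c≤2n _ A zero hM _ =
  subst (_≤ n + m + 2) (cong (c +_) (sym (+-identityʳ A)))
    (spreadBound-oneSided {n} {m} {c} bound c≤2n A (subst (_≤ m + 4) (+-identityʳ (3 * A)) hM))
spreadBound-even {n} {m} {c} bound _ c≤2m zero (suc B) _ hN =
  subst (c + suc B ≤_) (cong (_+ 2) (+-comm m n))
    (spreadBound-oneSided {m} {n} {c} (SpreadBound-swap {n} {m} {c} bound) c≤2m (suc B) hN)

doubled-≤ : ∀ {A B p q c Y} r → c + (A + B) ≤ Y → p + q ≤ r →
  (A + A + p) + (B + B + q) + (c + c) ≤ Y + Y + r
doubled-≤ {A} {B} {p} {q} {c} {Y} r X≤Y p+q≤r =
  subst (_≤ Y + Y + r) (regroup A B p q c) (+-mono-≤ (+-mono-≤ X≤Y X≤Y) p+q≤r)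
  where
  regroup : ∀ A B p q c → c + (A + B) + (c + (A + B)) + (p + q) ≡ (A + A + p) + (B + B + q) + (c + c)
  regroup = solve-∀

deficitSum-from : ∀ {n m c A B p q} → p ≤ 1 → q ≤ 1 →
  (p ≡ 1 → q ≡ 1 → c + (A + B) ≤ n + m + 1) → c + (A + B) ≤ n + m + 2 →
  (A + A + p) + (B + B + q) + (c + c) ≤ (n + m) + (n + m) + 5
deficitSum-from {n} {m} {c} {A} {B} (s≤s z≤n) (s≤s z≤n) odd _ =
  subst (A + A + 1 + (B + B + 1) + (c + c) ≤_) (twice+3 n m)
    (doubled-≤ {A} {B} {1} {1} {c} 3 (odd refl refl) (s≤s (s≤s z≤n)))
  where
  twice+3 : ∀ n m → (n + m + 1) + (n + m + 1) + 3 ≡ (n + m) + (n + m) + 5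
  twice+3 = solve-∀
deficitSum-from {n} {m} {c} {A} {B} {q = q} z≤n q≤1 _ even =
  subst (A + A + 0 + (B + B + q) + (c + c) ≤_) (twice+1 n m) (doubled-≤ {A} {B} {0} {q} {c} 1 even q≤1)
  where
  twice+1 : ∀ n m → (n + m + 2) + (n + m + 2) + 1 ≡ (n + m) + (n + m) + 5
  twice+1 = solve-∀
deficitSum-from {n} {m} {c} {A} {B} (s≤s z≤n) z≤n _ even =
  subst (A + A + 1 + (B + B + 0) + (c + c) ≤_) (twice+1 n m) (doubled-≤ {A} {B} {1} {0} {c} 1 even ≤-refl)
  where
  twice+1 : ∀ n m → (n + m + 2) + (n + m + 2) + 1 ≡ (n + m) + (n + m) + 5
  twice+1 = solve-∀

spreadBound⇒deficitSum : ∀ {n m c} → SpreadBound n m c → c ≤ n + n → c ≤ m + m →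
  ∀ A B p q → p ≤ 1 → q ≤ 1 →
  (A + A + p) + (A + p) + (B + q) ≤ m + 4 →
  (B + B + q) + (B + q) + (A + p) ≤ n + 4 →
  (A + A + p) + (B + B + q) + (c + c) ≤ (n + m) + (n + m) + 5
spreadBound⇒deficitSum {n} {m} {c} bound c≤2n c≤2m A B p q p≤1 q≤1 hM hN =
  deficitSum-from {n} {m} {c} {A} {B} p≤1 q≤1 odd
    (spreadBound-even {n} {m} {c} bound c≤2n c≤2m A B
      (≤-reduce (p + p + q) 0 (eqM A B p q) (sym (+-identityʳ (m + 4))) hM)
      (≤-reduce (q + q + p) 0 (eqN A B p q) (sym (+-identityʳ (n + 4))) hN))
  where
  eqM : ∀ A B p q → A + A + p + (A + p) + (B + q) ≡ 3 * A + B + (p + p + q) + 0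
  eqM = solve-∀
  eqN : ∀ A B p q → B + B + q + (B + q) + (A + p) ≡ A + 3 * B + (q + q + p) + 0
  eqN = solve-∀
  odd : p ≡ 1 → q ≡ 1 → c + (A + B) ≤ n + m + 1
  odd refl refl = spreadBound-odd {n} {m} {c} bound A B (≤-reduce 0 3 (eqM′ A B) (sym (+-assoc m 1 3)) hM)
                                            (≤-reduce 0 3 (eqN′ A B) (sym (+-assoc n 1 3)) hN)
    where
    eqM′ : ∀ A B → A + A + 1 + (A + 1) + (B + 1) ≡ 3 * A + B + 0 + 3
    eqM′ = solve-∀
    eqN′ : ∀ A B → B + B + 1 + (B + 1) + (A + 1) ≡ A + 3 * B + 0 + 3
    eqN′ = solve-∀

c+c+11≤t+t⇒c+6≤t : ∀ c t → c + c + 11 ≤ t + t → c + 6 ≤ t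
c+c+11≤t+t⇒c+6≤t c t h with c + 6 ≤? t
... | yes c+6≤t = c+6≤t
... | no  c+6≰t = ⊥-elim (n≮n (c + c + 10)
                    (subst (_≤ c + c + 10) (+-suc (c + c) 10)
                      (≤-trans h (≤-trans (+-mono-≤ t≤c+5 t≤c+5) (≤-reflexive (twice c))))))
  where
  t≤c+5 : t ≤ c + 5
  t≤c+5 = ≤-pred (subst (t <_) (+-suc c 5) (≰⇒> c+6≰t))
  twice : ∀ c → (c + 5) + (c + 5) ≡ c + c + 10
  twice = solve-∀

deficitBounds⇒c+6≤t : ∀ {n m c t} → SpreadBound n m c → c ≤ n + n → c ≤ m + m →
  DeficitBounds (n + 4) (m + 4) t → c + 6 ≤ t
deficitBounds⇒c+6≤t {n} {m} {c} {t} bound c≤2n c≤2m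
  record { rowDeficit = D ; colDeficit = E ; deficientRows = x ; deficientCols = y
         ; size≥ = size≥ ; M≥ = M≥ ; N≥ = N≥ ; rowDeficit≤ = D≤2x ; colDeficit≤ = E≤2y }
  with halve D x D≤2x | halve E y E≤2y
... | A , p , p≤1 , refl , A+p≤x | B , q , q≤1 , refl , B+q≤y =
  c+c+11≤t+t⇒c+6≤t c t (+-cancelˡ-≤ (n + 4 + (m + 4) + (n + 4 + (m + 4))) (c + c + 11) (t + t) (begin
    N+M+N+M + (c + c + 11)       ≡⟨ +-assoc N+M+N+M (c + c) 11 ⟨
    N+M+N+M + (c + c) + 11       ≤⟨ +-monoˡ-≤ 11 (+-monoˡ-≤ (c + c) size≥) ⟩
    t + t + (D + E) + (c + c) + 11 ≡⟨ regroup t (A + A + p) (B + B + q) c ⟩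
    t + t + (D + E + (c + c)) + 11 ≤⟨ +-monoˡ-≤ 11 (+-monoʳ-≤ (t + t) deficits) ⟩
    t + t + (n + m + (n + m) + 5) + 11 ≡⟨ final t n m ⟩
    N+M+N+M + (t + t)            ∎))
  where
  open ≤-Reasoning
  N+M+N+M : ℕ
  N+M+N+M = n + 4 + (m + 4) + (n + 4 + (m + 4))
  regroup : ∀ t D E c → t + t + (D + E) + (c + c) + 11 ≡ t + t + (D + E + (c + c)) + 11
  regroup = solve-∀
  final : ∀ t n m → t + t + (n + m + (n + m) + 5) + 11 ≡ n + 4 + (m + 4) + (n + 4 + (m + 4)) + (t + t)
  final = solve-∀
  deficits : (A + A + p) + (B + B + q) + (c + c) ≤ (n + m) + (n + m) + 5
  deficits = spreadBound⇒deficitSum {n} {m} {c} bound c≤2n c≤2m A B p q p≤1 q≤1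
    (≤-trans (+-mono-≤ (+-monoʳ-≤ (A + A + p) A+p≤x) B+q≤y) M≥)
    (≤-trans (+-mono-≤ (+-monoʳ-≤ (B + B + q) B+q≤y) A+p≤x) N≥)

emptyRow⇒M+M≤count : ∀ {N M} (T : VSet N M) → DegreeDominating T → ∀ i → rowDeg T i ≡ 0 → M + M ≤ count T
emptyRow⇒M+M≤count {N} {M} T dom i empty = begin
  M + M                   ≡⟨ M+M≡M*2 M ⟩
  M * 2                   ≡⟨ ∑-const M 2 ⟨
  ∑[ j < M ] 2            ≤⟨ ∑-mono-≤ 2≤colDeg ⟩
  ∑[ j < M ] colDeg T j   ≡⟨ ∑rowDeg≡∑colDeg T ⟨
  ∑[ i < N ] rowDeg T i   ≡⟨ count≡∑rowDeg T ⟨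
  count T                 ∎
  where
  open ≤-Reasoning
  M+M≡M*2 : ∀ M → M + M ≡ M * 2
  M+M≡M*2 = solve-∀
  2≤colDeg : ∀ j → 2 ≤ colDeg T j
  2≤colDeg j = ≤-trans (m≤m+n 2 (2 * χ (T i j))) (subst (λ r → 2 + 2 * χ (T i j) ≤ r + colDeg T j) empty (dom i j))

c+6≤[k+4]+[k+4] : ∀ {c} k → c ≤ k + k → c + 6 ≤ (k + 4) + (k + 4)
c+6≤[k+4]+[k+4] k c≤2k = ≤-trans (+-monoˡ-≤ 6 c≤2k) (+≡⇒≤ 2 (twice+8 k))
  where
  twice+8 : ∀ k → k + k + 6 + 2 ≡ (k + 4) + (k + 4)
  twice+8 = solve-∀

lowerBound+4 : ∀ {n m c} → 2 ≤ n → 2 ≤ m → LowerBound n m c → LowerBound (n + 4) (m + 4) (c + 6)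
lowerBound+4 {n} {m} {c} 2≤n 2≤m bound T dom
  with any? (λ i → rowDeg T i ≟ 0) | any? (λ j → colDeg T j ≟ 0)
... | yes (i , empty) | _ =
  ≤-trans (c+6≤[k+4]+[k+4] m (lowerBound≤m+m 2≤n 2≤m bound)) (emptyRow⇒M+M≤count T dom i empty)
... | no _ | yes (j , empty) =
  ≤-trans (c+6≤[k+4]+[k+4] n (lowerBound≤n+n 2≤n 2≤m bound))
    (subst (n + 4 + (n + 4) ≤_) (count-ᵀ T) (emptyRow⇒M+M≤count (T ᵀ) (DegreeDominating-ᵀ T dom) j empty))
... | no noEmptyRow | no noEmptyCol = deficitBounds⇒c+6≤t {n} {m} {c}
  (lowerBound⇒spreadBound 2≤n 2≤m bound) (lowerBound≤n+n 2≤n 2≤m bound) (lowerBound≤m+m 2≤n 2≤m bound)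
  (deficitBounds T dom (nonEmpty noEmptyRow) (nonEmpty noEmptyCol))
  where
  nonEmpty : ∀ {k} {f : Fin k → ℕ} → ¬ (∃[ i ] f i ≡ 0) → ∀ i → 1 ≤ f i
  nonEmpty none i = n≢0⇒n>0 (λ fi≡0 → none (i , fi≡0))

theorem2p13 : (n m : ℕ) → 2 ≤ n → 2 ≤ m →
    (S : VSet n m) → IsTotal2Dom S → IsGamma2t n m (count S) →
    (∀ (v : Fin n) → ∃[ w ] ((v , w) ∈S S)) →
    (∀ (w : Fin m) → ∃[ v ] ((v , w) ∈S S)) →
    IsGamma2t (n + 4) (m + 4) (count S + 6)
theorem2p13 n m 2≤n 2≤m S total2Dom (_ , minimal) rowsHit colsHit =
  (S ⊕ star , degreeDominating⇒total2Dom (S ⊕ star) extended-dominating , count-⊕ S star) ,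
  λ T total2Dom-T → lowerBound+4 2≤n 2≤m lowerBound T (total2Dom⇒degreeDominating T total2Dom-T)
  where
  lowerBound : LowerBound n m (count S)
  lowerBound T dom = minimal T (degreeDominating⇒total2Dom T dom)
  extended-dominating : DegreeDominating (S ⊕ star)
  extended-dominating = degreeDominating-⊕ S star (total2Dom⇒degreeDominating S total2Dom) star-degreeDominating
    (λ v → 1≤∣∣ (S v) (proj₂ (rowsHit v))) (λ w → 1≤∣∣ (λ v → S v w) (proj₂ (colsHit w)))
    star-rowDeg≥1 star-colDeg≥1
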